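{- If $\mathfrak{F}$ is an $\mathcal{L}_n$-frame, then the map $f$ from the set of MV-homomorphisms $\mathfrak{F}_\times\to\text{Ł}_n$ to the set of MV-homomorphisms $\mathfrak{B}(\mathfrak{F}_\times)\to\text{Ł}_n$ given by $u\mapsto u|_{\mathfrak{B}(\mathfrak{F}_\times)}$ is an isomorphism of $\mathcal{L}$-frames between $\mathfrak{Ce}(\mathfrak{F})_\sharp$ and $\mathfrak{Ce}(\mathfrak{F}_\sharp)$.
   Context: Let $\mathcal{L}=\{\neg,\to,1\}\cup\{\nabla_i : i\in I\}$, each $\nabla_i$ $k_i$-ary ($k_i\ge1$). Fix $n\ge1$; $\text{Ł}_n=\{0,\frac1n,\dots,1\}$ with $\neg x=1-x$, $x\to y=\min(1,1-x+y)$, $x\oplus y=\min(1,x+y)$. Write $m\preceq n$ for $m\mid n$. An $\mathcal{L}$-frame is $\langle W,(R_i)\rangle$, $W\ne\emptyset$, $R_i\subseteq W^{k_i+1}$; $\mathbf{v}\in R_iu$ means $(u,v_1,\dots,v_{k_i})\in R_i$. An $\mathcal{L}_n$-frame is $\langle W,(r_m)_{m\preceq n},(R_i)\rangle$ with $\langle W,(R_i)\rangle$ an $\mathcal{L}$-frame, $r_m\subseteq W$, $r_n=W$, $r_m\cap r_q=r_{\gcd(m,q)}$, $R_iu\subseteq r_m^{k_i}$ for $u\in r_m$; $\mathfrak{F}_\sharp$ is its $\mathcal{L}$-reduct. For an $\mathcal{L}$-algebra $\mathcal{A}$ with MV-reduct (all algebras here satisfy the modal operator axioms), the canonical $\mathcal{L}_n$-frame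 $\mathcal{A}^\times$ has universe the MV-homomorphisms $\mathcal{A}\to\text{Ł}_n$, $r_m$ those with values in $\text{Ł}_m$, and $(u,\mathbf{v})\in R_i$ iff for all $\mathbf{a}\in\mathcal{A}^{k_i}$, $u(\nabla_i\mathbf{a})=1$ implies $\max_\ell v_\ell(a_\ell)=1$; $\mathcal{A}^+=(\mathcal{A}^\times)_\sharp$. $\mathfrak{B}(\mathcal{A})$ is the subalgebra of idempotents ($a\oplus a=a$) with restricted operations. The complex algebra $\mathfrak{F}_{+_n}$ of an $\mathcal{L}$-frame is $\text{Ł}_n^W$ with pointwise $\neg,\to,1$ and $\nabla_i\boldsymbol\alpha(u)=\min\{\max_\ell\alpha_\ell(v_\ell):\mathbf{v}\in R_iu\}$; the tight complex algebra of an $\mathcal{L}_n$-frame is $\mathfrak{F}_\times=\prod_{u\in W}\text{Ł}_{s_u}$, $s_u=\gcd\{m\preceq n:u\in r_m\}$, with the same operations. Canonical extensions: $\mathfrak{Ce}(\mathfrak{F})=(\mathfrak{F}_\times)^\times$ for an $\mathcal{L}_n$-frame, and $\mathfrak{Ce}(\mathfrak{G})=(\mathfrak{B}(\mathfrak{G}_{+_n}))^+$ for an $\mathcal{L}$-frame $\mathfrak{G}$. -}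

module Defs where

open import Data.Nat using (ℕ; zero; suc; _+_; _*_; _∸_; _⊓_; _⊔_; _≤_)
open import Data.Nat.Properties
  using (m∸[m∸n]≡n; m≤n⇒m⊓n≡m; m≥n⇒m⊓n≡n; ≤-total; +-cancelˡ-≡; +-identityʳ)
open import Data.Nat.Divisibility using (_∣_; _∣0; m∣m*n)
open import Data.Nat.GCD using (gcd)
open import Data.Fin using (Fin)
import Data.Fin as F
open import Data.Product using (Σ; _×_; _,_; proj₁; proj₂)
open import Data.Sum using (inj₁; inj₂)
open import Relation.Nullary using (Dec; yes; no)
open import Relation.Binary.PropositionalEquality
  using (_≡_; refl; sym; trans; subst)

LEM : Set₁
LEM = (P : Set) → Dec P

-- Signature L = {¬, →, 1} ∪ {∇ᵢ : i ∈ I},  ∇ᵢ of arity kᵢ ≥ 1.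

record Sig : Set₁ where
  field
    I     : Set
    ar    : I → ℕ
    ar≥1  : ∀ i → 1 ≤ ar i

-- Ł_n is represented by {0,…,n} ⊆ ℕ, the number k standing for k/n.
-- Then ¬x = n ∸ x, x → y = (n ∸ x + y) ⊓ n, 1 = n, max = ⊔.

maxF : (k : ℕ) → (Fin k → ℕ) → ℕ
maxF zero    f = 0
maxF (suc k) f = f F.zero ⊔ maxF k (λ ℓ → f (F.suc ℓ))

module _ (L : Sig) where
  open Sig L

  record LFrame : Set₁ where
    field
      W : Set
      R : (i : I) → W → (Fin (ar i) → W) → Set

  -- L_n-frames  ⟨W, (r_m)_{m ∣ n}, (R_i)⟩  (r m is only relevant for m ∣ n)
  record LnFrame (n : ℕ) : Set₁ where
    field
      W     : Set
      r     : ℕ → W → Set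
      R     : (i : I) → W → (Fin (ar i) → W) → Set
      r-top : ∀ u → r n u
      r-gcd→ : ∀ m q u → m ∣ n → q ∣ n → r m u × r q u → r (gcd m q) u
      r-gcd← : ∀ m q u → m ∣ n → q ∣ n → r (gcd m q) u → r m u × r q u
      r-R   : ∀ i m u (v : Fin (ar i) → W) → m ∣ n → r m u → R i u v →
              ∀ ℓ → r m (v ℓ)

  _♯ : ∀ {n} → LnFrame n → LFrame
  F ♯ = record { W = LnFrame.W F ; R = LnFrame.R F }

  -- L-frames whose universe carries an equivalence (used for canonical
  -- frames, whose points are homomorphisms compared pointwise)
  record SFrame : Set₁ where
    field
      W   : Set
      _≈_ : W → W → Set
      R   : (i : I) → W → (Fin (ar i) → W) → Set

  record IsFrameIso (𝔄 𝔅 : SFrame) (g : SFrame.W 𝔄 → SFrame.W 𝔅) : Set where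
    open SFrame 𝔄 renaming (W to W₁; _≈_ to _≈₁_; R to R₁)
    open SFrame 𝔅 renaming (W to W₂; _≈_ to _≈₂_; R to R₂)
    field
      g-resp : ∀ x y → x ≈₁ y → g x ≈₂ g y
      g-inj  : ∀ x y → g x ≈₂ g y → x ≈₁ y
      g-surj : ∀ y → Σ W₁ λ x → g x ≈₂ y
      g-R→   : ∀ i u (v : Fin (ar i) → W₁) → R₁ i u v → R₂ i (g u) (λ ℓ → g (v ℓ))
      g-R←   : ∀ i u (v : Fin (ar i) → W₁) → R₂ i (g u) (λ ℓ → g (v ℓ)) → R₁ i u v

  -- L-algebras given as a subset (Mem) of a raw carrier closed under raw
  -- operations, with equality _≈_.  The operations of the (sub)algebra
  -- are the restrictions of the raw operations.

  record PAlg : Set₁ where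
    field
      Raw  : Set
      Mem  : Raw → Set
      _≈_  : Raw → Raw → Set
      neg  : Raw → Raw
      imp  : Raw → Raw → Raw
      one  : Raw
      nab  : (i : I) → (Fin (ar i) → Raw) → Raw

  record Hom (n : ℕ) (A : PAlg) : Set where
    open PAlg A
    field
      h        : (a : Raw) → Mem a → ℕ
      h-resp   : ∀ a b (p : Mem a) (q : Mem b) → a ≈ b → h a p ≡ h b q
      h-bound  : ∀ a (p : Mem a) → h a p ≤ n
      h-neg    : ∀ a (p : Mem a) (q : Mem (neg a)) → h (neg a) q ≡ n ∸ h a p
      h-imp    : ∀ a b (p : Mem a) (p' : Mem b) (q : Mem (imp a b)) →
                 h (imp a b) q ≡ (n ∸ h a p + h b p') ⊓ n
      h-one    : ∀ (q : Mem one) → h one q ≡ n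

  -- 𝒜⁺ : the L-reduct of the canonical L_n-frame 𝒜^×
  canon⁺ : (n : ℕ) → PAlg → SFrame
  canon⁺ n A = record
    { W   = Hom n A
    ; _≈_ = λ u v → ∀ a (p : Mem a) → Hom.h u a p ≡ Hom.h v a p
    ; R   = λ i u v → ∀ (a : Fin (ar i) → Raw) (p : ∀ ℓ → Mem (a ℓ))
                        (q : Mem (nab i a)) →
                      Hom.h u (nab i a) q ≡ n →
                      maxF (ar i) (λ ℓ → Hom.h (v ℓ) (a ℓ) (p ℓ)) ≡ n
    }
    where open PAlg A

  module Cx (lem : LEM) (n : ℕ) where

    search : (P : ℕ → Set) (d c fuel : ℕ) → ℕ
    search P d c zero = d
    search P d c (suc fuel) with lem (P c)
    ... | yes _ = c
    ... | no  _ = search P d (suc c) fuel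

    module _ (W : Set) (R : (i : I) → W → (Fin (ar i) → W) → Set) where

      rneg : (W → ℕ) → (W → ℕ)
      rneg α u = n ∸ α u

      rimp : (W → ℕ) → (W → ℕ) → (W → ℕ)
      rimp α β u = (n ∸ α u + β u) ⊓ n

      rone : W → ℕ
      rone u = n

      -- ∇ᵢα(u) = min { max_ℓ α_ℓ(v_ℓ) : v ∈ Rᵢu }   (min ∅ = 1)
      rnab : (i : I) → (Fin (ar i) → W → ℕ) → W → ℕ
      rnab i α u =
        search (λ c → Σ (Fin (ar i) → W) λ v →
                        R i u v × maxF (ar i) (λ ℓ → α ℓ (v ℓ)) ≡ c)
               n 0 (suc n)

      _≈ʷ_ : (W → ℕ) → (W → ℕ) → Set
      α ≈ʷ β = ∀ u → α u ≡ β u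

      roplus : (W → ℕ) → (W → ℕ) → (W → ℕ)
      roplus α β = rimp (rneg α) β

      mkAlg : ((W → ℕ) → Set) → PAlg
      mkAlg M = record
        { Raw = W → ℕ ; Mem = M ; _≈_ = _≈ʷ_
        ; neg = rneg ; imp = rimp ; one = rone ; nab = rnab }

    -- 𝔅(𝔊_{+n}) for an L-frame 𝔊 : idempotents of Ł_n^W
    B₊ : LFrame → PAlg
    B₊ 𝔊 = mkAlg W R (λ α → (∀ u → α u ≤ n) × (_≈ʷ_ W R (roplus W R α α) α))
      where open LFrame 𝔊

    -- k/n ∈ Ł_s  (as an element of Ł_n)
    InŁ : ℕ → ℕ → Set
    InŁ s k = k ≤ n × n ∣ k * s

    -- tight complex algebra 𝔉_× = ∏_u Ł_{s_u}
    module _ (𝔉 : LnFrame n) where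
      open LnFrame 𝔉

      sAux : W → ℕ → ℕ
      sAux u zero = 0
      sAux u (suc m) with lem ((suc m ∣ n) × r (suc m) u)
      ... | yes _ = gcd (suc m) (sAux u m)
      ... | no  _ = sAux u m

      -- s_u = gcd { m ⪯ n : u ∈ r_m }
      s : W → ℕ
      s u = sAux u n

      tight : PAlg
      tight = mkAlg W R (λ α → ∀ u → InŁ (s u) (α u))

    -- the inclusion 𝔅(𝔉_×) ⊆ 𝔉_× seen on 𝔅((𝔉♯)_{+n}) (same elements)

    idem⇒InŁ : ∀ s x → x ≤ n → (n ∸ (n ∸ x) + x) ⊓ n ≡ x → InŁ s x
    idem⇒InŁ s x x≤n e = x≤n , go (≤-total (x + x) n)
      where
        e'' : (x + x) ⊓ n ≡ x
        e'' = subst (λ t → (t + x) ⊓ n ≡ x) (m∸[m∸n]≡n x≤n) e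
        go : _ → n ∣ x * s
        go (inj₁ le) with +-cancelˡ-≡ x x 0
                            (trans (trans (sym (m≤n⇒m⊓n≡m le)) e'') (sym (+-identityʳ x)))
        ... | refl = n ∣0
        go (inj₂ ge) with trans (sym (m≥n⇒m⊓n≡n ge)) e''
        ... | refl = m∣m*n s

    restrict : (𝔉 : LnFrame n) → Hom n (tight 𝔉) → Hom n (B₊ (𝔉 ♯))
    restrict 𝔉 u = record
      { h       = λ a p → h a (ι a p)
      ; h-resp  = λ a b p q e → h-resp a b (ι a p) (ι b q) e
      ; h-bound = λ a p → h-bound a (ι a p)
      ; h-neg   = λ a p q → h-neg a (ι a p) (ι _ q)
      ; h-imp   = λ a b p p' q → h-imp a b (ι a p) (ι b p') (ι _ q)
      ; h-one   = λ q → h-one (ι _ q)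
      }
      where
        open Hom u
        ι : ∀ a → PAlg.Mem (B₊ (𝔉 ♯)) a → PAlg.Mem (tight 𝔉) a
        ι a (b , e) v = idem⇒InŁ (s 𝔉 v) (a v) (b v) (e v)

    Ce♯ : LnFrame n → SFrame
    Ce♯ 𝔉 = canon⁺ n (tight 𝔉)

    CeL : LFrame → SFrame
    CeL 𝔊 = canon⁺ n (B₊ 𝔊)

-- A homomorphism x into Ł_n from an MV-subalgebra of Ł_n^W containing all
-- characteristic functions determines an ultrafilter 𝒰 on W: the sets whose
-- characteristic function x sends to 1.  On the tight algebra 𝔉_×, x is
-- recovered from 𝒰: x(α) = k/n iff {α = k/n} ∈ 𝒰.  The reason is that the
-- function equal to gcd(k,n)/n on {α = k/n} and 0 elsewhere still lies in
-- 𝔉_×; n/gcd(k,n) copies of it sum to the characteristic function of that set,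
-- which forces x to send it to gcd(k,n)/n, and k/n is a multiple of it.  So
-- homomorphisms on 𝔉_× and on its Boolean part 𝔅(𝔉_×) both correspond exactly
-- to ultrafilters, which makes restriction bijective; it preserves and
-- reflects the relations because ∇ᵢ applied to the characteristic functions of
-- the sets {a_ℓ = 1} is the characteristic function of {∇ᵢ a = 1}.

module Submission where

open import Defs
open import Data.Bool using (Bool; true; false; if_then_else_; not; T)
open import Data.Empty using (⊥-elim)
open import Data.Fin using (Fin)
import Data.Fin as F
open import Data.Nat using (ℕ; zero; suc; _+_; _*_; _∸_; _⊓_; _⊔_; _≤_; _<_; z≤n; s≤s; _≟_; _<?_; _≤?_; >-nonZero)
open import Data.Nat.Properties
open import Data.Nat.Divisibility
  using (_∣_; divides; _∣0; m∣m*n; n∣m*n; ∣m+n∣m⇒∣n; ∣m∣n⇒∣m+n; ∣-antisym; ∣-refl)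
open import Data.Nat.GCD
  using (gcd; gcd[m,n]≤n; gcd[m,n]∣m; gcd[m,n]∣n; gcd-greatest; gcd-identityˡ; c*gcd[m,n]≡gcd[cm,cn])
open import Data.Product using (Σ; _,_; proj₁; proj₂)
open import Data.Sum using (_⊎_; inj₁; inj₂)
open import Data.Unit using (tt)
open import Relation.Nullary using (yes; no)
open import Relation.Nullary.Decidable using (⌊_⌋; toWitness; fromWitness; toWitnessFalse)
open import Function using (_∘_)
open import Relation.Binary.PropositionalEquality
  using (_≡_; refl; sym; trans; subst; cong; cong₂; module ≡-Reasoning)

module Łukasiewicz (n : ℕ) where

  infixr 5 _⇛_
  infixl 6 _⊕_

  _⇛_ : ℕ → ℕ → ℕ
  x ⇛ y = (n ∸ x + y) ⊓ n

  _⊕_ : ℕ → ℕ → ℕ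
  x ⊕ y = (n ∸ x) ⇛ y

  χ : {W : Set} → (W → Bool) → W → ℕ
  χ f u = if f u then n else 0

  _≐_ : {W : Set} → (W → ℕ) → ℕ → W → Bool
  (α ≐ k) u = ⌊ α u ≟ k ⌋

  ≐⇒≡ : ∀ {W : Set} (α : W → ℕ) {k} u → T ((α ≐ k) u) → α u ≡ k
  ≐⇒≡ α {k} u = toWitness {a? = α u ≟ k}

  ≡⇒≐ : ∀ {W : Set} (α : W → ℕ) {k} u → α u ≡ k → T ((α ≐ k) u)
  ≡⇒≐ α {k} u = fromWitness {a? = α u ≟ k}

  IsBoolean : ℕ → Set
  IsBoolean x = x ≡ 0 ⊎ x ≡ n

  ⇛-top : ∀ {x y} → x ≤ n → x ≤ y → x ⇛ y ≡ n
  ⇛-top {x} x≤n x≤y =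
    m≥n⇒m⊓n≡n (≤-trans (≤-reflexive (sym (m∸n+n≡m x≤n))) (+-monoʳ-≤ (n ∸ x) x≤y))

  ⇛-top⇒≤ : ∀ {x y} → x ≤ n → n ≤ x ⇛ y → x ≤ y
  ⇛-top⇒≤ {x} {y} x≤n n≤x⇛y =
    +-cancelˡ-≤ (n ∸ x) x y (≤-trans (≤-reflexive (m∸n+n≡m x≤n)) (≤-trans n≤x⇛y (m⊓n≤m _ _)))

  ⊕-multiple : ∀ t {x} → x ≤ n → x ⊕ ((t * x) ⊓ n) ≡ (suc t * x) ⊓ n
  ⊕-multiple t {x} x≤n rewrite m∸[m∸n]≡n x≤n | +-distribˡ-⊓ x (t * x) n
    | ⊓-assoc (x + t * x) (x + n) n | m≥n⇒m⊓n≡n (m≤n+m n x) = refl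

  ⊕-idem⇒boolean : ∀ {x} → x ≤ n → x ⊕ x ≡ x → IsBoolean x
  ⊕-idem⇒boolean {x} x≤n x⊕x≡x = by-cases (≤-total (x + x) n)
    where
      [x+x]⊓n≡x : (x + x) ⊓ n ≡ x
      [x+x]⊓n≡x = subst (λ t → (t + x) ⊓ n ≡ x) (m∸[m∸n]≡n x≤n) x⊕x≡x

      by-cases : x + x ≤ n ⊎ n ≤ x + x → IsBoolean x
      by-cases (inj₁ x+x≤n) = inj₁ (+-cancelˡ-≡ x x 0
        (trans (trans (sym (m≤n⇒m⊓n≡m x+x≤n)) [x+x]⊓n≡x) (sym (+-identityʳ x))))
      by-cases (inj₂ n≤x+x) = inj₂ (trans (sym [x+x]⊓n≡x) (m≥n⇒m⊓n≡n n≤x+x))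

  boolean⇒⊕-idem : ∀ {x} → IsBoolean x → x ⊕ x ≡ x
  boolean⇒⊕-idem (inj₁ refl) rewrite n∸n≡0 n = refl
  boolean⇒⊕-idem (inj₂ refl) rewrite n∸n≡0 n = m≥n⇒m⊓n≡n (m≤m+n n n)

  boolean⇒≤ : ∀ {x} → IsBoolean x → x ≤ n
  boolean⇒≤ (inj₁ refl) = z≤n
  boolean⇒≤ (inj₂ refl) = ≤-refl

  boolean-¬ : ∀ {x} → IsBoolean x → IsBoolean (n ∸ x)
  boolean-¬ (inj₁ refl) = inj₂ refl
  boolean-¬ (inj₂ refl) = inj₁ (n∸n≡0 n)

  boolean-⇛ : ∀ {x y} → IsBoolean x → IsBoolean y → IsBoolean (x ⇛ y)
  boolean-⇛ {y = y} (inj₁ refl) _ = inj₂ (m≥n⇒m⊓n≡n (m≤m+n n y))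
  boolean-⇛ (inj₂ refl) (inj₁ refl) rewrite n∸n≡0 n = inj₁ refl
  boolean-⇛ (inj₂ refl) (inj₂ refl) rewrite n∸n≡0 n = inj₂ (⊓-idem n)

  boolean-⊔ : ∀ {x y} → IsBoolean x → IsBoolean y → IsBoolean (x ⊔ y)
  boolean-⊔ (inj₁ refl) y = y
  boolean-⊔ (inj₂ refl) (inj₁ refl) = inj₂ (⊔-identityʳ n)
  boolean-⊔ (inj₂ refl) (inj₂ refl) = inj₂ (⊔-idem n)

  boolean-if : ∀ b → IsBoolean (if b then n else 0)
  boolean-if true  = inj₂ refl
  boolean-if false = inj₁ refl

  boolean⇒gcd≡n : ∀ {k} → IsBoolean k → gcd k n ≡ n
  boolean⇒gcd≡n (inj₁ refl) = gcd-identityˡ n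
  boolean⇒gcd≡n (inj₂ refl) = ∣-antisym (gcd[m,n]∣n n n) (gcd-greatest ∣-refl ∣-refl)

  boolean-≡ : ∀ {x y} → IsBoolean x → IsBoolean y →
              (x ≡ n → y ≡ n) → (y ≡ n → x ≡ n) → x ≡ y
  boolean-≡ (inj₁ refl) (inj₁ refl) _ _ = refl
  boolean-≡ (inj₁ refl) (inj₂ refl) _ y⇒x = y⇒x refl
  boolean-≡ (inj₂ refl) (inj₁ refl) x⇒y _ = sym (x⇒y refl)
  boolean-≡ (inj₂ refl) (inj₂ refl) _ _ = refl

  multiple≡top : 1 ≤ n → ∀ m {x} → x ≤ n →
                 (suc m * x) ⊓ n ≡ n → (m * x) ⊓ n ≤ n ∸ x → suc m * x ≡ n
  multiple≡top n≥1 m {x} x≤n top below with ≤-total (m * x) n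
  ... | inj₁ mx≤n = ≤-antisym
          (≤-trans (+-monoʳ-≤ x (subst (_≤ n ∸ x) (m≤n⇒m⊓n≡m mx≤n) below)) (≤-reflexive (m+[n∸m]≡n x≤n)))
          (≤-trans (≤-reflexive (sym top)) (m⊓n≤m _ _))
  ... | inj₂ n≤mx = ⊥-elim (<⇒≱ n≥1 (subst (n ≤_) (trans (cong (m *_) x≡0) (*-zeroʳ m)) n≤mx))
    where
      x+n≤n : x + n ≤ n
      x+n≤n = ≤-trans (+-monoʳ-≤ x (subst (_≤ n ∸ x) (m≥n⇒m⊓n≡n n≤mx) below)) (≤-reflexive (m+[n∸m]≡n x≤n))
      x≡0 : x ≡ 0
      x≡0 = n≤0⇒n≡0 (+-cancelʳ-≤ n x 0 x+n≤n)

  maxF-≤ : ∀ k f → (∀ ℓ → f ℓ ≤ n) → maxF k f ≤ n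
  maxF-≤ zero    f f≤n = z≤n
  maxF-≤ (suc k) f f≤n = ⊔-lub (f≤n F.zero) (maxF-≤ k (f ∘ F.suc) (f≤n ∘ F.suc))

  ≤-maxF : ∀ k f ℓ → f ℓ ≤ maxF k f
  ≤-maxF (suc k) f F.zero    = m≤m⊔n _ _
  ≤-maxF (suc k) f (F.suc ℓ) = ≤-trans (≤-maxF k (f ∘ F.suc) ℓ) (m≤n⊔m _ _)

  maxF≡top⇒ : 1 ≤ n → ∀ k f → maxF k f ≡ n → Σ (Fin k) λ ℓ → f ℓ ≡ n
  maxF≡top⇒ n≥1 zero    f max≡n = ⊥-elim (<⇒≢ n≥1 max≡n)
  maxF≡top⇒ n≥1 (suc k) f max≡n with ≤-total (f F.zero) (maxF k (f ∘ F.suc))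
  ... | inj₁ f₀≤ = let ℓ , fℓ≡n = maxF≡top⇒ n≥1 k (f ∘ F.suc) (trans (sym (m≤n⇒m⊔n≡n f₀≤)) max≡n)
                   in F.suc ℓ , fℓ≡n
  ... | inj₂ ≤f₀ = F.zero , trans (sym (m≥n⇒m⊔n≡m ≤f₀)) max≡n

  maxF≡top⇐ : ∀ k f → (∀ ℓ → f ℓ ≤ n) → Σ (Fin k) (λ ℓ → f ℓ ≡ n) → maxF k f ≡ n
  maxF≡top⇐ k f f≤n (ℓ , fℓ≡n) = ≤-antisym (maxF-≤ k f f≤n) (subst (_≤ maxF k f) fℓ≡n (≤-maxF k f ℓ))

  maxF-boolean : ∀ k f → (∀ ℓ → IsBoolean (f ℓ)) → IsBoolean (maxF k f)
  maxF-boolean zero    f _      = inj₁ refl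
  maxF-boolean (suc k) f f-bool = boolean-⊔ (f-bool F.zero) (maxF-boolean k (f ∘ F.suc) (f-bool ∘ F.suc))

  if-mono : ∀ a b → (T a → T b) → (if a then n else 0) ≤ (if b then n else 0)
  if-mono false _     _   = z≤n
  if-mono true  false a⇒b = ⊥-elim (a⇒b tt)
  if-mono true  true  _   = ≤-refl

  if-≤⇛ : ∀ a {x y} → x ≤ n → (T a → x ≤ y) → (if a then n else 0) ≤ x ⇛ y
  if-≤⇛ false _   _   = z≤n
  if-≤⇛ true  x≤n a⇒x≤y = ≤-reflexive (sym (⇛-top x≤n (a⇒x≤y tt)))

  if-not : ∀ a → (if not a then n else 0) ≡ n ∸ (if a then n else 0)
  if-not true  = sym (n∸n≡0 n)
  if-not false = refl

  χ≐≡top : ∀ {W : Set} (α : W → ℕ) {k} u → α u ≡ k → χ (α ≐ k) u ≡ n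
  χ≐≡top α {k} u αu≡k with α u ≟ k
  ... | yes _   = refl
  ... | no αu≢k = ⊥-elim (αu≢k αu≡k)

  χ≐≡top⇒ : 1 ≤ n → ∀ {W : Set} (α : W → ℕ) {k} u → χ (α ≐ k) u ≡ n → α u ≡ k
  χ≐≡top⇒ n≥1 α {k} u χ≡n with α u ≟ k
  ... | yes αu≡k = αu≡k
  ... | no  _    = ⊥-elim (<⇒≢ n≥1 χ≡n)

  maxF-χ≐top⇒ : 1 ≤ n → ∀ k f → (∀ ℓ → f ℓ ≤ n) → maxF k (χ (f ≐ n)) ≡ n → maxF k f ≡ n
  maxF-χ≐top⇒ n≥1 k f f≤n max≡n =
    let ℓ , χ≡n = maxF≡top⇒ n≥1 k (χ (f ≐ n)) max≡n
    in maxF≡top⇐ k f f≤n (ℓ , χ≐≡top⇒ n≥1 f ℓ χ≡n)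

  maxF-χ≐top⇐ : 1 ≤ n → ∀ k f → maxF k f ≡ n → maxF k (χ (f ≐ n)) ≡ n
  maxF-χ≐top⇐ n≥1 k f max≡n =
    let ℓ , fℓ≡n = maxF≡top⇒ n≥1 k f max≡n
    in maxF≡top⇐ k (χ (f ≐ n)) (λ ℓ → boolean⇒≤ (boolean-if _)) (ℓ , χ≐≡top f ℓ fℓ≡n)

module Nabla (L : Sig) (lem : LEM) (n : ℕ) where
  open Sig L
  open Cx L lem n using (search; rnab)
  open Łukasiewicz n

  search-spec : ∀ P d c fuel → search P d c fuel ≡ d ⊎ P (search P d c fuel)
  search-spec P d c zero       = inj₁ refl
  search-spec P d c (suc fuel) with lem (P c)
  ... | yes Pc = inj₂ Pc
  ... | no  _ = search-spec P d (suc c) fuel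

  search-least : ∀ P d c fuel {c'} → c ≤ c' → c' < c + fuel → P c' → search P d c fuel ≤ c'
  search-least P d c zero {c'} c≤c' c'<c+0 _ = ⊥-elim (<⇒≱ (subst (c' <_) (+-identityʳ c) c'<c+0) c≤c')
  search-least P d c (suc fuel) {c'} c≤c' c'<c+fuel Pc' with lem (P c)
  ... | yes _  = c≤c'
  ... | no ¬Pc with c ≟ c'
  ...   | yes refl = ⊥-elim (¬Pc Pc')
  ...   | no  c≢c' = search-least P d (suc c) fuel (≤∧≢⇒< c≤c' c≢c') (subst (c' <_) (+-suc c fuel) c'<c+fuel) Pc'

  module _ (W : Set) (R : (i : I) → W → (Fin (ar i) → W) → Set) where

    rnab≡top⇐ : ∀ i α w → (∀ v → R i w v → maxF (ar i) (λ ℓ → α ℓ (v ℓ)) ≡ n) → rnab W R i α w ≡ n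
    rnab≡top⇐ i α w all-top with search-spec _ n 0 (suc n)
    ... | inj₁ default         = default
    ... | inj₂ (v , r , max≡) = trans (sym max≡) (all-top v r)

    rnab≡top⇒ : ∀ i α w → (∀ ℓ u → α ℓ u ≤ n) → rnab W R i α w ≡ n →
                ∀ v → R i w v → maxF (ar i) (λ ℓ → α ℓ (v ℓ)) ≡ n
    rnab≡top⇒ i α w α≤n ∇≡n v r = ≤-antisym max≤n
      (subst (_≤ _) ∇≡n (search-least _ n 0 (suc n) z≤n (s≤s max≤n) (v , r , refl)))
      where
        max≤n = maxF-≤ (ar i) (λ ℓ → α ℓ (v ℓ)) (λ ℓ → α≤n ℓ (v ℓ))

    rnab-boolean : ∀ i α w → (∀ ℓ u → IsBoolean (α ℓ u)) → IsBoolean (rnab W R i α w)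
    rnab-boolean i α w α-bool with search-spec _ n 0 (suc n)
    ... | inj₁ default        = inj₂ default
    ... | inj₂ (v , r , max≡) = subst IsBoolean max≡ (maxF-boolean _ _ (λ ℓ → α-bool ℓ (v ℓ)))

    rnab-χ≐top : 1 ≤ n → ∀ i α w → (∀ ℓ u → α ℓ u ≤ n) →
                 rnab W R i (λ ℓ → χ (α ℓ ≐ n)) w ≡ χ (rnab W R i α ≐ n) w
    rnab-χ≐top n≥1 i α w α≤n =
      boolean-≡ (rnab-boolean i β w (λ ℓ u → boolean-if _)) (boolean-if _) ∇β≡n⇒ ∇α≡n⇒
      where
        β : Fin (ar i) → W → ℕ
        β ℓ = χ (α ℓ ≐ n)

        ∇β≡n⇒ : rnab W R i β w ≡ n → χ (rnab W R i α ≐ n) w ≡ n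
        ∇β≡n⇒ ∇β≡n = χ≐≡top (rnab W R i α) w (rnab≡top⇐ i α w λ v r →
          maxF-χ≐top⇒ n≥1 (ar i) (λ ℓ → α ℓ (v ℓ)) (λ ℓ → α≤n ℓ (v ℓ))
            (rnab≡top⇒ i β w (λ ℓ u → boolean⇒≤ (boolean-if _)) ∇β≡n v r))

        ∇α≡n⇒ : χ (rnab W R i α ≐ n) w ≡ n → rnab W R i β w ≡ n
        ∇α≡n⇒ χ≡n = rnab≡top⇐ i β w λ v r →
          maxF-χ≐top⇐ n≥1 (ar i) (λ ℓ → α ℓ (v ℓ))
            (rnab≡top⇒ i α w α≤n (χ≐≡top⇒ n≥1 (rnab W R i α) w χ≡n) v r)

module _ (L : Sig) (lem : LEM) (n : ℕ) (n≥1 : 1 ≤ n) where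
  open Sig L
  open Łukasiewicz n

  module Ultrafilter
    (W : Set) (R : (i : I) → W → (Fin (ar i) → W) → Set) (M : (W → ℕ) → Set)
    (M-≤   : ∀ {α} → M α → ∀ u → α u ≤ n)
    (M-¬   : ∀ {α} → M α → M (λ u → n ∸ α u))
    (M-⇛   : ∀ {α β} → M α → M β → M (λ u → α u ⇛ β u))
    (M-top : M (λ _ → n))
    (M-χ   : ∀ f → M (χ f))
    where

    A : PAlg L
    A = Cx.mkAlg L lem n W R M

    infixr 7 _·_
    _·_ : ℕ → (W → ℕ) → W → ℕ
    (zero  · α) u = n ∸ n
    (suc t · α) u = α u ⊕ (t · α) u

    M-· : ∀ t {α} → M α → M (t · α)
    M-· zero    _  = M-¬ M-top
    M-· (suc t) Mα = M-⇛ (M-¬ Mα) (M-· t Mα)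

    ·-pointwise : ∀ t {α} u → α u ≤ n → (t · α) u ≡ (t * α u) ⊓ n
    ·-pointwise zero    u _ = n∸n≡0 n
    ·-pointwise (suc t) {α} u αu≤n rewrite ·-pointwise t {α} u αu≤n = ⊕-multiple t αu≤n

    atom : (W → ℕ) → ℕ → W → ℕ
    atom α k u = if (α ≐ k) u then gcd k n else 0

    atom≡gcd : ∀ α {k} u → T ((α ≐ k) u) → atom α k u ≡ gcd k n
    atom≡gcd α {k} u αu≐k with α u ≟ k
    ... | yes _ = refl

    module _ (x : Hom L n A) where
      open Hom x

      h-irrelevant : ∀ {α} (p q : M α) → h α p ≡ h α q
      h-irrelevant p q = h-resp _ _ p q (λ _ → refl)

      h-top : ∀ {α} (p : M α) → (∀ u → α u ≡ n) → h α p ≡ n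
      h-top p α≡n = trans (h-resp _ _ p M-top α≡n) (h-one M-top)

      h-zero : ∀ {α} (p : M α) → (∀ u → α u ≡ 0) → h α p ≡ 0
      h-zero p α≡0 = begin
        h _ p                 ≡⟨ h-resp _ _ p (M-¬ M-top) (λ u → trans (α≡0 u) (sym (n∸n≡0 n))) ⟩
        h _ (M-¬ M-top)       ≡⟨ h-neg _ M-top (M-¬ M-top) ⟩
        n ∸ h (λ _ → n) M-top ≡⟨ cong (n ∸_) (h-one M-top) ⟩
        n ∸ n                 ≡⟨ n∸n≡0 n ⟩
        0                     ∎
        where open ≡-Reasoning

      h-mono : ∀ {α β} (p : M α) (q : M β) → (∀ u → α u ≤ β u) → h α p ≤ h β q
      h-mono {α} {β} p q α≤β = ⇛-top⇒≤ (h-bound α p) (≤-reflexive (begin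
        n               ≡⟨ sym (h-top (M-⇛ p q) (λ u → ⇛-top (M-≤ p u) (α≤β u))) ⟩
        h _ (M-⇛ p q)   ≡⟨ h-imp α β p q (M-⇛ p q) ⟩
        h α p ⇛ h β q   ∎))
        where open ≡-Reasoning

      modus-ponens : ∀ {γ α β} (r : M γ) (p : M α) (q : M β) →
                     (∀ u → γ u ≤ α u ⇛ β u) → h γ r ≡ n → h α p ≤ h β q
      modus-ponens {γ} {α} {β} r p q γ≤α⇛β hγ≡n = ⇛-top⇒≤ (h-bound α p) (begin
        n              ≡⟨ sym hγ≡n ⟩
        h γ r          ≤⟨ h-mono r (M-⇛ p q) γ≤α⇛β ⟩
        h _ (M-⇛ p q)  ≡⟨ h-imp α β p q (M-⇛ p q) ⟩
        h α p ⇛ h β q  ∎)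
        where open ≤-Reasoning

      h-boolean : ∀ {α} (p : M α) → (∀ u → IsBoolean (α u)) → IsBoolean (h α p)
      h-boolean {α} p α-bool = ⊕-idem⇒boolean (h-bound α p) (begin
        h α p ⊕ h α p         ≡⟨ cong (_⇛ h α p) (sym (h-neg α p (M-¬ p))) ⟩
        h _ (M-¬ p) ⇛ h α p   ≡⟨ sym (h-imp _ α (M-¬ p) p (M-⇛ (M-¬ p) p)) ⟩
        h _ (M-⇛ (M-¬ p) p)   ≡⟨ h-resp _ α _ p (λ u → boolean⇒⊕-idem (α-bool u)) ⟩
        h α p                 ∎)
        where open ≡-Reasoning

      h-· : ∀ t {α} (p : M α) → h (t · α) (M-· t p) ≡ (t * h α p) ⊓ n
      h-· zero    p = h-zero (M-· zero p) (λ _ → n∸n≡0 n)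
      h-· (suc t) {α} p = begin
        h (suc t · α) (M-· (suc t) p)       ≡⟨ h-imp _ _ (M-¬ p) (M-· t p) _ ⟩
        h _ (M-¬ p) ⇛ h (t · α) (M-· t p)   ≡⟨ cong₂ _⇛_ (h-neg α p (M-¬ p)) (h-· t p) ⟩
        h α p ⊕ ((t * h α p) ⊓ n)           ≡⟨ ⊕-multiple t (h-bound α p) ⟩
        (suc t * h α p) ⊓ n                 ∎
        where open ≡-Reasoning

      𝒰 : (W → Bool) → Set
      𝒰 f = h (χ f) (M-χ f) ≡ n

      𝒰-const : ∀ {b} → 𝒰 (λ _ → b) → T b
      𝒰-const {true}  _  = tt
      𝒰-const {false} 𝒰∅ = <⇒≢ n≥1 (trans (sym (h-zero (M-χ _) (λ _ → refl))) 𝒰∅)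

      𝒰-full : ∀ {f} → (∀ u → T (f u)) → 𝒰 f
      𝒰-full {f} f-full = h-top (M-χ f) χ≡n
        where
          χ≡n : ∀ u → χ f u ≡ n
          χ≡n u with f u | f-full u
          ... | true | _ = refl

      𝒰-∩ : ∀ {f g k} → 𝒰 f → 𝒰 g → (∀ u → T (f u) → T (g u) → T (k u)) → 𝒰 k
      𝒰-∩ {f} {g} {k} 𝒰f 𝒰g f∩g⊆k = ≤-antisym (h-bound _ (M-χ k))
        (subst (_≤ h (χ k) (M-χ k)) 𝒰g (modus-ponens (M-χ f) (M-χ g) (M-χ k) χf≤χg⇛χk 𝒰f))
        where
          χf≤χg⇛χk : ∀ u → χ f u ≤ χ g u ⇛ χ k u
          χf≤χg⇛χk u = if-≤⇛ (f u) (boolean⇒≤ (boolean-if (g u)))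
                         (λ fu → if-mono (g u) (k u) (f∩g⊆k u fu))

      𝒰-mono : ∀ {f g} → 𝒰 f → (∀ u → T (f u) → T (g u)) → 𝒰 g
      𝒰-mono 𝒰f f⊆g = 𝒰-∩ 𝒰f 𝒰f (λ u fu _ → f⊆g u fu)

      𝒰-ultra : ∀ f → 𝒰 f ⊎ 𝒰 (not ∘ f)
      𝒰-ultra f with h-boolean (M-χ f) (λ u → boolean-if (f u))
      ... | inj₂ 𝒰f   = inj₁ 𝒰f
      ... | inj₁ hχ≡0 = inj₂ (begin
        h (χ (not ∘ f)) (M-χ (not ∘ f)) ≡⟨ h-resp _ _ _ (M-¬ (M-χ f)) (λ u → if-not (f u)) ⟩
        h _ (M-¬ (M-χ f))               ≡⟨ h-neg _ (M-χ f) _ ⟩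
        n ∸ h (χ f) (M-χ f)             ≡⟨ cong (n ∸_) hχ≡0 ⟩
        n                               ∎)
        where open ≡-Reasoning

      h-agree : ∀ {f α β} (p : M α) (q : M β) → 𝒰 f → (∀ u → T (f u) → α u ≡ β u) → h α p ≡ h β q
      h-agree {f} p q 𝒰f α≡β = ≤-antisym (half p q α≡β) (half q p (λ u fu → sym (α≡β u fu)))
        where
          half : ∀ {α β} (p : M α) (q : M β) → (∀ u → T (f u) → α u ≡ β u) → h α p ≤ h β q
          half p q α≡β = modus-ponens (M-χ f) p q
            (λ u → if-≤⇛ (f u) (M-≤ p u) (λ fu → ≤-reflexive (α≡β u fu))) 𝒰f

      𝒰-≐-resp : ∀ {α β k} → (∀ u → α u ≡ β u) → 𝒰 (α ≐ k) → 𝒰 (β ≐ k)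
      𝒰-≐-resp {α} {β} α≡β 𝒰α≐k = 𝒰-mono 𝒰α≐k λ u e → ≡⇒≐ β u (trans (sym (α≡β u)) (≐⇒≡ α u e))

      𝒰-≐-¬ : ∀ {α k} → 𝒰 (α ≐ k) → 𝒰 ((λ u → n ∸ α u) ≐ (n ∸ k))
      𝒰-≐-¬ {α} 𝒰α≐k = 𝒰-mono 𝒰α≐k λ u e → ≡⇒≐ (λ u → n ∸ α u) u (cong (n ∸_) (≐⇒≡ α u e))

      𝒰-≐-⇛ : ∀ {α β k k′} → 𝒰 (α ≐ k) → 𝒰 (β ≐ k′) → 𝒰 ((λ u → α u ⇛ β u) ≐ (k ⇛ k′))
      𝒰-≐-⇛ {α} {β} 𝒰α≐k 𝒰β≐k′ = 𝒰-∩ 𝒰α≐k 𝒰β≐k′ λ u e e′ →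
        ≡⇒≐ (λ u → α u ⇛ β u) u (cong₂ _⇛_ (≐⇒≡ α u e) (≐⇒≡ β u e′))

      level-≤ : ∀ {α k} → (∀ u → α u ≤ n) → 𝒰 (α ≐ k) → k ≤ n
      level-≤ {α} {k} α≤n 𝒰α≐k = toWitness (𝒰-const (𝒰-mono {g = λ _ → ⌊ k ≤? n ⌋} 𝒰α≐k
        λ u αu≐k → fromWitness (subst (_≤ n) (≐⇒≡ α u αu≐k) (α≤n u))))

      level-unique : ∀ {α k k′} → 𝒰 (α ≐ k) → 𝒰 (α ≐ k′) → k ≡ k′
      level-unique {α} {k} {k′} 𝒰α≐k 𝒰α≐k′ = toWitness (𝒰-const (𝒰-∩ {k = λ _ → ⌊ k ≟ k′ ⌋} 𝒰α≐k 𝒰α≐k′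
        λ u αu≐k αu≐k′ → fromWitness (trans (sym (≐⇒≡ α u αu≐k)) (≐⇒≡ α u αu≐k′))))

      level-exists : ∀ α → (∀ u → α u ≤ n) → Σ ℕ λ k → 𝒰 (α ≐ k)
      level-exists α α≤n = below (suc n) (𝒰-full λ u → fromWitness (s≤s (α≤n u)))
        where
          below : ∀ j → 𝒰 (λ u → ⌊ α u <? j ⌋) → Σ ℕ λ k → 𝒰 (α ≐ k)
          below zero    𝒰α<0 = ⊥-elim (𝒰-const (𝒰-mono {g = λ _ → false} 𝒰α<0
                                   λ u αu<0 → n≮0 (toWitness {a? = α u <? 0} αu<0)))
          below (suc j) 𝒰α≤j with 𝒰-ultra (α ≐ j)
          ... | inj₁ 𝒰α≐j = j , 𝒰α≐j
          ... | inj₂ 𝒰α≢j = below j (𝒰-∩ 𝒰α≤j 𝒰α≢j λ u αu≤j αu≢j →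
                                fromWitness (≤∧≢⇒< (≤-pred (toWitness αu≤j)) (toWitnessFalse αu≢j)))

      h-atom : ∀ {α k} (p : M (atom α k)) → 𝒰 (α ≐ k) → h (atom α k) p ≡ gcd k n
      h-atom {α} {k} p 𝒰α≐k with gcd[m,n]∣n k n
      ... | divides zero    n≡0   = ⊥-elim (<⇒≢ n≥1 (sym n≡0))
      ... | divides (suc m) n≡m+1g =
        *-cancelˡ-≡ _ _ (suc m) (trans (multiple≡top n≥1 m (h-bound _ p) top below) n≡m+1g)
        where
          open ≡-Reasoning
          g = gcd k n

          m+1·atom≡χ : ∀ u → (suc m · atom α k) u ≡ χ (α ≐ k) u
          m+1·atom≡χ u rewrite ·-pointwise (suc m) {atom α k} u (M-≤ p u) with α u ≟ k
          ... | yes _ = trans (cong (_⊓ n) (sym n≡m+1g)) (⊓-idem n)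
          ... | no  _ = cong (_⊓ n) (*-zeroʳ (suc m))

          m·atom≤¬atom : ∀ u → (m · atom α k) u ≤ n ∸ atom α k u
          m·atom≤¬atom u rewrite ·-pointwise m {atom α k} u (M-≤ p u) with α u ≟ k
          ... | yes _ = ≤-trans (m⊓n≤m _ n) (≤-reflexive (sym (trans (cong (_∸ g) n≡m+1g) (m+n∸m≡n g (m * g)))))
          ... | no  _ = m⊓n≤n _ n

          top : (suc m * h (atom α k) p) ⊓ n ≡ n
          top = begin
            (suc m * h (atom α k) p) ⊓ n            ≡⟨ sym (h-· (suc m) p) ⟩
            h (suc m · atom α k) (M-· (suc m) p)    ≡⟨ h-resp _ _ _ (M-χ (α ≐ k)) m+1·atom≡χ ⟩
            h (χ (α ≐ k)) (M-χ (α ≐ k))             ≡⟨ 𝒰α≐k ⟩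
            n                                        ∎

          below : (m * h (atom α k) p) ⊓ n ≤ n ∸ h (atom α k) p
          below = ≤-trans (≤-reflexive (sym (h-· m p)))
                    (≤-trans (h-mono (M-· m p) (M-¬ p) m·atom≤¬atom) (≤-reflexive (h-neg _ p (M-¬ p))))

      h-level : ∀ {α k} (p : M α) → M (atom α k) → 𝒰 (α ≐ k) → h α p ≡ k
      h-level {α} {k} p M-atom 𝒰α≐k with gcd[m,n]∣m k n
      ... | divides j k≡jg = begin
        h α p                              ≡⟨ h-agree p (M-· j M-atom) 𝒰α≐k α≡j·atom ⟩
        h (j · atom α k) (M-· j M-atom)    ≡⟨ h-· j M-atom ⟩
        (j * h (atom α k) M-atom) ⊓ n      ≡⟨ cong (λ y → (j * y) ⊓ n) (h-atom M-atom 𝒰α≐k) ⟩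
        (j * gcd k n) ⊓ n                  ≡⟨ cong (_⊓ n) (sym k≡jg) ⟩
        k ⊓ n                              ≡⟨ m≤n⇒m⊓n≡m k≤n ⟩
        k                                  ∎
        where
          open ≡-Reasoning
          k≤n = level-≤ (M-≤ p) 𝒰α≐k

          α≡j·atom : ∀ u → T ((α ≐ k) u) → α u ≡ (j · atom α k) u
          α≡j·atom u αu≐k = begin
            α u                      ≡⟨ ≐⇒≡ α u αu≐k ⟩
            k                        ≡⟨ sym (m≤n⇒m⊓n≡m k≤n) ⟩
            k ⊓ n                    ≡⟨ cong (_⊓ n) k≡jg ⟩
            (j * gcd k n) ⊓ n        ≡⟨ cong (λ y → (j * y) ⊓ n) (sym (atom≡gcd α u αu≐k)) ⟩
            (j * atom α k u) ⊓ n     ≡⟨ sym (·-pointwise j u (M-≤ M-atom u)) ⟩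
            (j · atom α k) u         ∎

      value⇒𝒰 : ∀ {α k} (p : M α) → (∀ j → M (atom α j)) → h α p ≡ k → 𝒰 (α ≐ k)
      value⇒𝒰 {α} p M-atom hα≡k =
        let j , 𝒰α≐j = level-exists α (M-≤ p)
        in subst (λ j → 𝒰 (α ≐ j)) (trans (sym (h-level p (M-atom j) 𝒰α≐j)) hα≡k) 𝒰α≐j

module TightValues (L : Sig) (lem : LEM) (n : ℕ) where
  open Łukasiewicz n
  open Cx L lem n using (InŁ)

  InŁ-top : ∀ {t} → InŁ t n
  InŁ-top {t} = ≤-refl , m∣m*n t

  InŁ-zero : ∀ {t} → InŁ t 0
  InŁ-zero = z≤n , n ∣0

  InŁ-¬ : ∀ {t x} → InŁ t x → InŁ t (n ∸ x)
  InŁ-¬ {t} {x} (x≤n , n∣xt) = m∸n≤m n x , ∣m+n∣m⇒∣n (subst (n ∣_) nt≡xt+[n∸x]t (m∣m*n t)) n∣xt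
    where
      nt≡xt+[n∸x]t : n * t ≡ x * t + (n ∸ x) * t
      nt≡xt+[n∸x]t = trans (cong (_* t) (sym (m+[n∸m]≡n x≤n))) (*-distribʳ-+ t x (n ∸ x))

  InŁ-⇛ : ∀ {t x y} → InŁ t x → InŁ t y → InŁ t (x ⇛ y)
  InŁ-⇛ {t} {x} {y} Łx (_ , n∣yt) with ≤-total (n ∸ x + y) n
  ... | inj₁ ≤n rewrite m≤n⇒m⊓n≡m ≤n =
        ≤n , subst (n ∣_) (sym (*-distribʳ-+ t (n ∸ x) y)) (∣m∣n⇒∣m+n (proj₂ (InŁ-¬ Łx)) n∣yt)
  ... | inj₂ n≤ rewrite m≥n⇒m⊓n≡n n≤ = InŁ-top

  InŁ-if : ∀ {t} b → InŁ t (if b then n else 0)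
  InŁ-if {t} true  = InŁ-top {t}
  InŁ-if {t} false = InŁ-zero {t}

  InŁ-gcd : 1 ≤ n → ∀ {t k} → InŁ t k → InŁ t (gcd k n)
  InŁ-gcd n≥1 {t} {k} (_ , n∣kt) = gcd[m,n]≤n k n {{>-nonZero n≥1}} ,
    subst (n ∣_) tgcd≡gcd*t (gcd-greatest (subst (n ∣_) (*-comm k t) n∣kt) (n∣m*n t))
    where
      tgcd≡gcd*t : gcd (t * k) (t * n) ≡ gcd k n * t
      tgcd≡gcd*t = trans (sym (c*gcd[m,n]≡gcd[cm,cn] t k n)) (*-comm t (gcd k n))

module CanonicalExtension (lem : LEM) (L : Sig) (n : ℕ) (n≥1 : 1 ≤ n) (𝔉 : LnFrame L n) where
  open Sig L
  open LnFrame 𝔉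
  open Łukasiewicz n
  open TightValues L lem n
  open Cx L lem n using (tight; B₊; restrict; rnab; idem⇒InŁ; s)

  Tight : (W → ℕ) → Set
  Tight = PAlg.Mem (tight 𝔉)

  Idem : (W → ℕ) → Set
  Idem = PAlg.Mem (B₊ (_♯ L 𝔉))

  idem⇒boolean : ∀ {α} → Idem α → ∀ u → IsBoolean (α u)
  idem⇒boolean (α≤n , α-idem) u = ⊕-idem⇒boolean (α≤n u) (α-idem u)

  boolean⇒idem : ∀ {α} → (∀ u → IsBoolean (α u)) → Idem α
  boolean⇒idem α-bool = (λ u → boolean⇒≤ (α-bool u)) , (λ u → boolean⇒⊕-idem (α-bool u))

  χ-idem : ∀ f → Idem (χ f)
  χ-idem f = boolean⇒idem (λ u → boolean-if (f u))

  idem⇒tight : ∀ {α} → Idem α → Tight α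
  idem⇒tight {α} (α≤n , α-idem) u = idem⇒InŁ (s 𝔉 u) (α u) (α≤n u) (α-idem u)

  module 𝕋 = Ultrafilter L lem n n≥1 W R Tight
    (λ p u → proj₁ (p u)) (λ p u → InŁ-¬ (p u)) (λ p q u → InŁ-⇛ (p u) (q u))
    (λ u → InŁ-top {s 𝔉 u}) (λ f u → InŁ-if (f u))

  module 𝔹 = Ultrafilter L lem n n≥1 W R Idem
    proj₁
    (λ p → boolean⇒idem (λ u → boolean-¬ (idem⇒boolean p u)))
    (λ p q → boolean⇒idem (λ u → boolean-⇛ (idem⇒boolean p u) (idem⇒boolean q u)))
    (boolean⇒idem (λ _ → inj₂ refl)) χ-idem

  tight-atom : ∀ {α} → Tight α → ∀ k → Tight (𝕋.atom α k)
  tight-atom {α} p k u with α u ≟ k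
  ... | yes refl = InŁ-gcd n≥1 (p u)
  ... | no  _    = InŁ-zero {s 𝔉 u}

  idem-atom : ∀ {α} → Idem α → ∀ k → Idem (𝔹.atom α k)
  idem-atom {α} p k = boolean⇒idem atom-boolean
    where
      atom-boolean : ∀ u → IsBoolean (𝔹.atom α k u)
      atom-boolean u with α u ≟ k
      ... | yes refl = inj₂ (boolean⇒gcd≡n (idem⇒boolean p u))
      ... | no  _    = inj₁ refl

  module _ (y : Hom L n 𝔹.A) where
    open 𝔹 using (𝒰; 𝒰-full; 𝒰-≐-resp; 𝒰-≐-¬; 𝒰-≐-⇛; level-exists; level-unique; level-≤; h-level)

    level : ∀ α → Tight α → ℕ
    level α p = proj₁ (level-exists y α (λ u → proj₁ (p u)))

    𝒰-level : ∀ α (p : Tight α) → 𝒰 y (α ≐ level α p)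
    𝒰-level α p = proj₂ (level-exists y α (λ u → proj₁ (p u)))

    level-resp : ∀ α β (p : Tight α) (q : Tight β) → (∀ u → α u ≡ β u) → level α p ≡ level β q
    level-resp α β p q α≡β = level-unique y (𝒰-≐-resp y α≡β (𝒰-level α p)) (𝒰-level β q)

    level-¬ : ∀ α (p : Tight α) (q : Tight (λ u → n ∸ α u)) → level (λ u → n ∸ α u) q ≡ n ∸ level α p
    level-¬ α p q = level-unique y (𝒰-level (λ u → n ∸ α u) q) (𝒰-≐-¬ y (𝒰-level α p))

    level-⇛ : ∀ α β (p : Tight α) (p′ : Tight β) (q : Tight (λ u → α u ⇛ β u)) →
              level (λ u → α u ⇛ β u) q ≡ level α p ⇛ level β p′
    -- The explicit {k} keeps the unifier from unfolding level, which is very slow.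
    level-⇛ α β p p′ q = level-unique y {k = level (λ u → α u ⇛ β u) q}
      (𝒰-level (λ u → α u ⇛ β u) q) (𝒰-≐-⇛ y (𝒰-level α p) (𝒰-level β p′))

    level-top : (q : Tight (λ _ → n)) → level (λ _ → n) q ≡ n
    level-top q = level-unique y (𝒰-level (λ _ → n) q) (𝒰-full y λ u → ≡⇒≐ (λ _ → n) u refl)

    extend : Hom L n 𝕋.A
    extend = record
      { h       = level
      ; h-resp  = level-resp
      ; h-bound = λ α p → level-≤ y (λ u → proj₁ (p u)) (𝒰-level α p)
      ; h-neg   = level-¬
      ; h-imp   = level-⇛
      ; h-one   = level-top
      }

    restrict-extend : ∀ α (p : Idem α) → Hom.h (restrict 𝔉 extend) α p ≡ Hom.h y α p
    restrict-extend α p = sym (h-level y p (idem-atom p _) (𝒰-level α (idem⇒tight p)))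

  _≈ᴮ_ : Hom L n 𝕋.A → Hom L n 𝕋.A → Set
  x ≈ᴮ z = ∀ α (p : Idem α) → Hom.h (restrict 𝔉 x) α p ≡ Hom.h (restrict 𝔉 z) α p

  𝒰-restrict : ∀ x z → x ≈ᴮ z → ∀ {f} → 𝕋.𝒰 x f → 𝕋.𝒰 z f
  𝒰-restrict x z x≈z {f} 𝒰f = begin
    Hom.h z (χ f) _                            ≡⟨ 𝕋.h-irrelevant z _ _ ⟩
    Hom.h z (χ f) (idem⇒tight (χ-idem f))      ≡⟨ sym (x≈z (χ f) (χ-idem f)) ⟩
    Hom.h x (χ f) (idem⇒tight (χ-idem f))      ≡⟨ 𝕋.h-irrelevant x _ _ ⟩
    Hom.h x (χ f) _                            ≡⟨ 𝒰f ⟩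
    n                                          ∎
    where open ≡-Reasoning

  restrict-injective : ∀ x z → x ≈ᴮ z → ∀ α (p : Tight α) → Hom.h x α p ≡ Hom.h z α p
  restrict-injective x z x≈z α p =
    sym (𝕋.h-level z p (tight-atom p _) (𝒰-restrict x z x≈z (𝕋.value⇒𝒰 x p (tight-atom p) refl)))

  restrict-preserves-R : ∀ i u v → SFrame.R (Cx.Ce♯ L lem n 𝔉) i u v →
    SFrame.R (Cx.CeL L lem n (_♯ L 𝔉)) i (restrict 𝔉 u) (λ ℓ → restrict 𝔉 (v ℓ))
  restrict-preserves-R i u v uRv a p q = uRv a (λ ℓ → idem⇒tight (p ℓ)) (idem⇒tight q)

  restrict-reflects-R : ∀ i u v →
    SFrame.R (Cx.CeL L lem n (_♯ L 𝔉)) i (restrict 𝔉 u) (λ ℓ → restrict 𝔉 (v ℓ)) →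
    SFrame.R (Cx.Ce♯ L lem n 𝔉) i u v
  restrict-reflects-R i u v uRv a p q u∇a≡n =
    let ℓ , vℓbℓ≡n = maxF≡top⇒ n≥1 (ar i) _ (uRv b (λ ℓ → χ-idem (a ℓ ≐ n)) ∇b-idem u∇b≡n)
    in maxF≡top⇐ (ar i) _ (λ ℓ → Hom.h-bound (v ℓ) _ (p ℓ))
         (ℓ , 𝕋.h-level (v ℓ) (p ℓ) (tight-atom (p ℓ) n) (trans (𝕋.h-irrelevant (v ℓ) _ _) vℓbℓ≡n))
    where
      b : Fin (ar i) → W → ℕ
      b ℓ = χ (a ℓ ≐ n)

      ∇b≡χ : ∀ w → rnab W R i b w ≡ χ (rnab W R i a ≐ n) w
      ∇b≡χ w = Nabla.rnab-χ≐top L lem n W R n≥1 i a w (λ ℓ w → proj₁ (p ℓ w))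

      ∇b-idem : Idem (rnab W R i b)
      ∇b-idem = boolean⇒idem (λ w → subst IsBoolean (sym (∇b≡χ w)) (boolean-if _))

      u∇b≡n : Hom.h u (rnab W R i b) (idem⇒tight ∇b-idem) ≡ n
      u∇b≡n = trans (Hom.h-resp u _ _ _ (λ w → InŁ-if {s 𝔉 w} _) ∇b≡χ)
                    (𝕋.value⇒𝒰 u q (tight-atom q) u∇a≡n)

lemma3p12 : (lem : LEM) (L : Sig) (n : ℕ) → 1 ≤ n → (𝔉 : LnFrame L n) →
    IsFrameIso L (Cx.Ce♯ L lem n 𝔉) (Cx.CeL L lem n (_♯ L 𝔉)) (Cx.restrict L lem n 𝔉)
lemma3p12 lem L n n≥1 𝔉 = record
  { g-resp = λ x z x≈z α p → x≈z α (idem⇒tight p)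
  ; g-inj  = restrict-injective
  ; g-surj = λ y → extend y , restrict-extend y
  ; g-R→   = restrict-preserves-R
  ; g-R←   = restrict-reflects-R
  }
  where open CanonicalExtension lem L n n≥1 𝔉
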